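{- Let $k,l$ be positive integers and let $t=a^kb^la$ (the word consisting of $k$ copies of $a$, then $l$ copies of $b$, then one $a$, where $a\ne b$). Then every finite simple graph is $t$-representable.
   Context: Two words are isomorphic if one is obtained from the other by a bijective renaming of letters. For a word $w$ and letters $x,y$, $w|_{xy}$ denotes the subword of $w$ consisting of all occurrences of $x$ and $y$ (in order). A word $u$ over the two letters $\{a,b\}$ occurs in $w|_{xy}$ ($x\neq y$) if some contiguous factor of $w|_{xy}$ is isomorphic to $u$; otherwise $w|_{xy}$ avoids $u$. For a word $t$ on two letters, a graph $G=(V,E)$ is $t$-representable if there is a word $w$ over the alphabet $V$ containing each letter of $V$ at least once such that for all distinct $x,y\in V$, $xy\in E$ if and only if $w|_{xy}$ avoids $t$. -}

module Defs where

open import Data.Nat using (ℕ)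
open import Data.Bool using (Bool; true; false; if_then_else_)
open import Data.Fin using (Fin; _≟_)
open import Data.List using (List; []; _∷_; _++_; map; replicate; filter)
open import Data.List.Membership.Propositional using (_∈_)
open import Data.Product using (Σ; ∃; _×_; _,_)
open import Data.Sum using (_⊎_)
open import Relation.Nullary using (¬_)
open import Relation.Nullary.Decidable using (_⊎-dec_)
open import Relation.Binary.PropositionalEquality using (_≡_; _≢_)

record SimpleGraph (n : ℕ) : Set where
  field
    adj   : Fin n → Fin n → Bool
    sym   : ∀ x y → adj x y ≡ adj y x
    irrfl : ∀ x → adj x x ≡ false

-- Two words are isomorphic if one is obtained from the other by a bijective
-- renaming of letters: a map φ on the letters of u, injective on the letters
-- occurring in u, sending u to v (φ is then a bijection between the letter sets).
Isomorphic : {A B : Set} → List A → List B → Set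
Isomorphic {A} {B} u v =
  Σ (A → B) λ φ → (∀ x y → x ∈ u → y ∈ u → φ x ≡ φ y → x ≡ y) × map φ u ≡ v

Occurs : {A B : Set} → List A → List B → Set
Occurs {A} {B} u v =
  Σ (List B) λ p → Σ (List B) λ f → Σ (List B) λ s →
    (v ≡ p ++ f ++ s) × Isomorphic u f

restrict : {n : ℕ} → List (Fin n) → Fin n → Fin n → List (Fin n)
restrict w x y = filter (λ z → (z ≟ x) ⊎-dec (z ≟ y)) w

Representable : {n : ℕ} → List Bool → SimpleGraph n → Set
Representable {n} t G =
  Σ (List (Fin n)) λ w → (∀ v → v ∈ w) ×
    (∀ x y → x ≢ y →
      ((SimpleGraph.adj G x y ≡ true → ¬ Occurs t (restrict w x y)) ×
       (¬ Occurs t (restrict w x y) → SimpleGraph.adj G x y ≡ true)))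

-- t = a^k b^l a, with a = false, b = true.
tWord : ℕ → ℕ → List Bool
tWord k l = replicate k false ++ replicate l true ++ (false ∷ [])

module Submission where

-- Call a word a concatenation of *long runs* if it is a product of blocks
-- eᵐ with m > l.  Such a word never contains a factor c dˡ c with c ≠ d:
-- the dˡ would have to be a union of whole blocks, each longer than l.
-- Hence it avoids every word isomorphic to aᵏ bˡ a.
--
-- The representing word is  w = (∏_v v^{l+1}) · (∏_{uv non-edge} gadget u v)
-- with  gadget u v = v^{l+1} uᵏ vˡ u^{l+1}.  The first part makes every
-- vertex occur.  For a non-edge xy, w|_{xy} contains gadget x y, which
-- contains the factor xᵏ yˡ x.  For an edge xz, no gadget involves both x
-- and z, so each gadget restricts to a single run of length > l or to the
-- empty word, and w|_{xz} is a concatenation of long runs.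

open import Defs
open import Level using (0ℓ)
open import Data.Nat using (ℕ; zero; suc; _+_; _<_; _≥_; s≤s)
open import Data.Nat.Properties using (n<1+n; m≤n+m; m≤m+n)
open import Data.Bool using (Bool; true; false; if_then_else_)
open import Data.Fin using (Fin; _≟_)
open import Data.List using (List; []; _∷_; _++_; [_]; map; replicate; filter; concatMap; allFin; cartesianProduct)
open import Data.List.Properties using (filter-++; filter-all; filter-none; ++-assoc; ++-identityʳ; ∷-injective; concatMap-++)
open import Data.List.Membership.Propositional using (_∈_)
open import Data.List.Membership.Propositional.Properties using (∈-allFin; ∈-++⁺ʳ; ∈-++⁺ˡ; ∈-∃++; ∈-concatMap⁺; ∈-cartesianProduct⁺)
open import Data.List.Relation.Unary.All using (All)
open import Data.List.Relation.Unary.All.Properties using (replicate⁺; ++⁺)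
open import Data.List.Relation.Unary.Any as Any using (here; there)
open import Data.Product using (_×_; _,_; proj₁; proj₂)
open import Data.Sum using (_⊎_; inj₁; inj₂)
open import Data.Empty using (⊥-elim)
open import Relation.Nullary using (¬_; Dec; yes; no)
open import Relation.Nullary.Decidable using (_⊎-dec_)
open import Relation.Unary using (Pred; Decidable)
open import Relation.Binary.PropositionalEquality using (_≡_; _≢_; refl; sym; trans; cong; subst; module ≡-Reasoning)

private
  variable
    A : Set

replicate-++ : ∀ a b (e : A) → replicate a e ++ replicate b e ≡ replicate (a + b) e
replicate-++ zero    b e = refl
replicate-++ (suc a) b e = cong (e ∷_) (replicate-++ a b e)

replicate-snoc : ∀ m (e : A) ys → replicate (suc m) e ++ ys ≡ replicate m e ++ e ∷ ys
replicate-snoc zero    e ys = refl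
replicate-snoc (suc m) e ys = cong (e ∷_) (replicate-snoc m e ys)

data LongRuns {A : Set} (L : ℕ) : List A → Set where
  []  : LongRuns L []
  run : ∀ {r} (e : A) m → L < m → LongRuns L r → LongRuns L (replicate m e ++ r)

single-run : ∀ {L m} (e : A) → L < m → LongRuns L (replicate m e)
single-run {m = m} e L<m = subst (LongRuns _) (++-identityʳ (replicate m e)) (run e m L<m [])

merged-run : ∀ {L} a b (e : A) → L < a + b → LongRuns L (replicate a e ++ replicate b e)
merged-run a b e L<a+b = subst (LongRuns _) (sym (replicate-++ a b e)) (single-run e L<a+b)

LongRuns-++ : ∀ {L} {r r′ : List A} → LongRuns L r → LongRuns L r′ → LongRuns L (r ++ r′)
LongRuns-++ []                      q = q
LongRuns-++ {r′ = r′} (run {r} e m L<m p) q =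
  subst (LongRuns _) (sym (++-assoc (replicate m e) r r′)) (run e m L<m (LongRuns-++ p q))

first-run-letter : ∀ {e d c : A} {r s} i m → i < m →
  replicate m e ++ r ≡ replicate i d ++ c ∷ s → e ≡ c
first-run-letter zero    (suc m) _         eq = proj₁ (∷-injective eq)
first-run-letter (suc i) (suc m) (s≤s i<m) eq = first-run-letter i m i<m (proj₂ (∷-injective eq))

-- A concatenation of runs longer than L = suc l′ cannot begin with d^L c, c ≢ d:
-- positions 0 and L both lie in its first run.
no-short-prefix : ∀ l′ {r : List A} {c d s} → LongRuns (suc l′) r → c ≢ d →
  r ≢ replicate (suc l′) d ++ c ∷ s
no-short-prefix l′ []                    c≢d ()
no-short-prefix l′ (run e (suc m) L<m _) c≢d eq =
  c≢d (trans (sym (first-run-letter (suc l′) (suc m) L<m eq)) (proj₁ (∷-injective eq)))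

-- The leading partial
-- run eʲ makes the statement stable under deleting a first letter.
no-isolated-run : ∀ l′ {r : List A} → LongRuns (suc l′) r → ∀ j (e : A) p {c d s} →
  c ≢ d → replicate j e ++ r ≢ p ++ c ∷ replicate (suc l′) d ++ c ∷ s
no-isolated-run l′ []               zero e (_ ∷ _) c≢d ()
no-isolated-run l′ []               zero e []      c≢d ()
no-isolated-run l′ (run e′ m _ rs)  zero e p       c≢d eq = no-isolated-run l′ rs m e′ p c≢d eq
no-isolated-run l′ rs (suc zero)    e []           c≢d eq = no-short-prefix l′ rs c≢d (proj₂ (∷-injective eq))
no-isolated-run l′ rs (suc (suc j)) e []           c≢d eq =
  c≢d (trans (sym (proj₁ (∷-injective eq))) (proj₁ (∷-injective (proj₂ (∷-injective eq)))))
no-isolated-run l′ rs (suc j)       e (_ ∷ p)      c≢d eq = no-isolated-run l′ rs j e p c≢d (proj₂ (∷-injective eq))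

map-tWord : ∀ {B : Set} (φ : Bool → B) k l →
  map φ (tWord k l) ≡ replicate k (φ false) ++ replicate l (φ true) ++ [ φ false ]
map-tWord φ (suc k) l       = cong (φ false ∷_) (map-tWord φ k l)
map-tWord φ zero    (suc l) = cong (φ true ∷_) (map-tWord φ zero l)
map-tWord φ zero    zero    = refl

LongRuns-avoid : ∀ k′ l′ {r : List A} → LongRuns (suc l′) r → ¬ Occurs (tWord (suc k′) (suc l′)) r
LongRuns-avoid k′ l′ {r} rs (p , f , s , r≡pfs , φ , φ-inj , φt≡f) =
  no-isolated-run l′ rs zero (φ false) (p ++ replicate k′ c) c≢d r≡factor
  where
  open ≡-Reasoning
  c = φ false
  d = φ true
  L = suc l′
  c≢d : c ≢ d
  c≢d c≡d with φ-inj false true (here refl) (there (∈-++⁺ʳ (replicate k′ false) (here refl))) c≡d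
  ... | ()
  r≡factor : r ≡ (p ++ replicate k′ c) ++ c ∷ replicate L d ++ c ∷ s
  r≡factor = begin
    r                                                   ≡⟨ r≡pfs ⟩
    p ++ f ++ s
      ≡⟨ cong (λ g → p ++ g ++ s) (trans (sym φt≡f) (map-tWord φ (suc k′) L)) ⟩
    p ++ (replicate (suc k′) c ++ replicate L d ++ [ c ]) ++ s
      ≡⟨ cong (p ++_) (++-assoc (replicate (suc k′) c) _ s) ⟩
    p ++ replicate (suc k′) c ++ (replicate L d ++ [ c ]) ++ s
      ≡⟨ cong (λ g → p ++ replicate (suc k′) c ++ g) (++-assoc (replicate L d) [ c ] s) ⟩
    p ++ replicate (suc k′) c ++ replicate L d ++ c ∷ s ≡⟨ cong (p ++_) (replicate-snoc k′ c _) ⟩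
    p ++ replicate k′ c ++ c ∷ replicate L d ++ c ∷ s   ≡⟨ sym (++-assoc p _ _) ⟩
    (p ++ replicate k′ c) ++ c ∷ replicate L d ++ c ∷ s ∎

Occurs-++ˡ : ∀ {t : List Bool} (a : List A) {v} → Occurs t v → Occurs t (a ++ v)
Occurs-++ˡ a {v} (p , f , s , v≡pfs , iso) =
  a ++ p , f , s , trans (cong (a ++_) v≡pfs) (sym (++-assoc a p (f ++ s))) , iso

Occurs-++ʳ : ∀ {t : List Bool} {v : List A} (b : List A) → Occurs t v → Occurs t (v ++ b)
Occurs-++ʳ {v = v} b (p , f , s , v≡pfs , iso) = p , f , s ++ b , v++b≡ , iso
  where
  open ≡-Reasoning
  v++b≡ : v ++ b ≡ p ++ f ++ s ++ b
  v++b≡ = begin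
    v ++ b              ≡⟨ cong (_++ b) v≡pfs ⟩
    (p ++ f ++ s) ++ b  ≡⟨ ++-assoc p (f ++ s) b ⟩
    p ++ (f ++ s) ++ b  ≡⟨ cong (p ++_) (++-assoc f s b) ⟩
    p ++ f ++ s ++ b    ∎

tWord-iso : ∀ {A : Set} k l {x y : A} → x ≢ y → Isomorphic (tWord k l) (replicate k x ++ replicate l y ++ [ x ])
tWord-iso {A} k l {x} {y} x≢y = φ , φ-inj , map-tWord φ k l
  where
  φ : Bool → A
  φ b = if b then y else x
  φ-inj : ∀ a b → a ∈ tWord k l → b ∈ tWord k l → φ a ≡ φ b → a ≡ b
  φ-inj false false _ _ _   = refl
  φ-inj true  true  _ _ _   = refl
  φ-inj false true  _ _ x≡y = ⊥-elim (x≢y x≡y)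
  φ-inj true  false _ _ y≡x = ⊥-elim (x≢y (sym y≡x))

gadget : ℕ → ℕ → A → A → List A
gadget k l u v = replicate (suc l) v ++ replicate k u ++ replicate l v ++ replicate (suc l) u

gadget-occurs : ∀ k l {x y : A} → x ≢ y → Occurs (tWord k l) (gadget k l x y)
gadget-occurs k l {x} {y} x≢y =
  replicate (suc l) y , replicate k x ++ replicate l y ++ [ x ] , replicate l x ,
  cong (replicate (suc l) y ++_) (sym (trans (++-assoc (replicate k x) _ _)
    (cong (replicate k x ++_) (++-assoc (replicate l y) [ x ] _)))) ,
  tWord-iso k l x≢y

module Restriction {P : Pred A 0ℓ} (P? : Decidable P) where

  filter-keep : ∀ m {e} → P e → filter P? (replicate m e) ≡ replicate m e
  filter-keep m Pe = filter-all P? (replicate⁺ m Pe)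

  filter-drop : ∀ m {e} → ¬ P e → filter P? (replicate m e) ≡ []
  filter-drop m ¬Pe = filter-none P? (replicate⁺ m ¬Pe)

  filter-run : ∀ {L m} e → L < m → LongRuns L (filter P? (replicate m e))
  filter-run {m = m} e L<m with P? e
  ... | yes Pe = subst (LongRuns _) (sym (filter-keep m Pe)) (single-run e L<m)
  ... | no ¬Pe = subst (LongRuns _) (sym (filter-drop m ¬Pe)) []

  filter-concatMap : ∀ {B : Set} {L} (f : B → List A) xs →
    (∀ x → LongRuns L (filter P? (f x))) → LongRuns L (filter P? (concatMap f xs))
  filter-concatMap f []       pieces = []
  filter-concatMap f (x ∷ xs) pieces =
    subst (LongRuns _) (sym (filter-++ P? (f x) (concatMap f xs)))
      (LongRuns-++ (pieces x) (filter-concatMap f xs pieces))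

  filter-infix-occurs : ∀ {t : List Bool} a g b →
    Occurs t (filter P? g) → Occurs t (filter P? (a ++ g ++ b))
  filter-infix-occurs a g b occ rewrite filter-++ P? a (g ++ b) | filter-++ P? g b =
    Occurs-++ˡ (filter P? a) (Occurs-++ʳ (filter P? b) occ)

  filter-gadget-runs : ∀ k l (u v : A) → filter P? (gadget k l u v) ≡
    filter P? (replicate (suc l) v) ++ filter P? (replicate k u) ++
    filter P? (replicate l v) ++ filter P? (replicate (suc l) u)
  filter-gadget-runs k l u v
    rewrite filter-++ P? (replicate (suc l) v) (replicate k u ++ replicate l v ++ replicate (suc l) u)
          | filter-++ P? (replicate k u) (replicate l v ++ replicate (suc l) u)
          | filter-++ P? (replicate l v) (replicate (suc l) u)
    = refl

  filter-gadget : ∀ k l u v → ¬ (P u × P v) → LongRuns l (filter P? (gadget k l u v))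
  filter-gadget k l u v not-both = by-cases (P? u) (P? v)
    where
    by-cases : Dec (P u) → Dec (P v) → LongRuns l (filter P? (gadget k l u v))
    by-cases (yes Pu) (yes Pv) = ⊥-elim (not-both (Pu , Pv))
    by-cases (yes Pu) (no ¬Pv)
      rewrite filter-gadget-runs k l u v
            | filter-drop (suc l) ¬Pv | filter-keep k Pu | filter-drop l ¬Pv | filter-keep (suc l) Pu
      = merged-run k (suc l) u (m≤n+m (suc l) k)
    by-cases (no ¬Pu) (yes Pv)
      rewrite filter-gadget-runs k l u v
            | filter-keep (suc l) Pv | filter-drop k ¬Pu | filter-keep l Pv | filter-drop (suc l) ¬Pu
            | ++-identityʳ (replicate l v)
      = merged-run (suc l) l v (m≤m+n (suc l) l)
    by-cases (no ¬Pu) (no ¬Pv)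
      rewrite filter-gadget-runs k l u v
            | filter-drop (suc l) ¬Pv | filter-drop k ¬Pu | filter-drop l ¬Pv | filter-drop (suc l) ¬Pu
      = []

module Representation (k l n : ℕ) (G : SimpleGraph n) where
  open SimpleGraph G using (adj) renaming (sym to adj-sym)

  gadgetFor : Fin n × Fin n → List (Fin n)
  gadgetFor (u , v) with u ≟ v | adj u v
  ... | no _ | false = gadget k l u v
  ... | _    | _     = []

  pairs : List (Fin n × Fin n)
  pairs = cartesianProduct (allFin n) (allFin n)

  loops gadgets word : List (Fin n)
  loops   = concatMap (λ v → replicate (suc l) v) (allFin n)
  gadgets = concatMap gadgetFor pairs
  word    = loops ++ gadgets

  word-covers : ∀ v → v ∈ word
  word-covers v =
    ∈-++⁺ˡ (∈-concatMap⁺ (λ u → replicate (suc l) u) (Any.map (λ { refl → here refl }) (∈-allFin v)))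

  module _ (x y : Fin n) where
    isEnd? : Decidable (λ z → z ≡ x ⊎ z ≡ y)
    isEnd? z = (z ≟ x) ⊎-dec (z ≟ y)

    open Restriction isEnd?

    nonEdge-not-inside : adj x y ≡ true → ∀ u v → u ≢ v → adj u v ≡ false →
      ¬ ((u ≡ x ⊎ u ≡ y) × (v ≡ x ⊎ v ≡ y))
    nonEdge-not-inside xy∈E u v u≢v uv∉E (inj₁ refl , inj₁ refl) = u≢v refl
    nonEdge-not-inside xy∈E u v u≢v uv∉E (inj₁ refl , inj₂ refl)
      with trans (sym xy∈E) uv∉E
    ... | ()
    nonEdge-not-inside xy∈E u v u≢v uv∉E (inj₂ refl , inj₁ refl)
      with trans (sym xy∈E) (trans (adj-sym x y) uv∉E)
    ... | ()
    nonEdge-not-inside xy∈E u v u≢v uv∉E (inj₂ refl , inj₂ refl) = u≢v refl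

    edge-restriction : adj x y ≡ true → LongRuns l (filter isEnd? word)
    edge-restriction xy∈E =
      subst (LongRuns l) (sym (filter-++ isEnd? loops gadgets))
        (LongRuns-++ (filter-concatMap _ (allFin n) (λ v → filter-run v (n<1+n l)))
                     (filter-concatMap gadgetFor pairs gadget-pieces))
      where
      gadget-pieces : ∀ p → LongRuns l (filter isEnd? (gadgetFor p))
      gadget-pieces (u , v) with u ≟ v | adj u v in uv∈E
      ... | yes _  | _     = []
      ... | no _   | true  = []
      ... | no u≢v | false = filter-gadget k l u v (nonEdge-not-inside xy∈E u v u≢v uv∈E)

    gadgetFor-nonEdge : x ≢ y → adj x y ≡ false → gadgetFor (x , y) ≡ gadget k l x y
    gadgetFor-nonEdge x≢y xy∉E with x ≟ y | adj x y | xy∉E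
    ... | yes x≡y | _     | _    = ⊥-elim (x≢y x≡y)
    ... | no _    | false | refl = refl

    gadget-within : All (λ z → z ≡ x ⊎ z ≡ y) (gadget k l x y)
    gadget-within = ++⁺ (replicate⁺ (suc l) (inj₂ refl)) (++⁺ (replicate⁺ k (inj₁ refl))
                      (++⁺ (replicate⁺ l (inj₂ refl)) (replicate⁺ (suc l) (inj₁ refl))))

    nonEdge-restriction : x ≢ y → adj x y ≡ false → Occurs (tWord k l) (filter isEnd? word)
    nonEdge-restriction x≢y xy∉E
      with ys , zs , pairs≡ ← ∈-∃++ (∈-cartesianProduct⁺ (∈-allFin x) (∈-allFin y))
      rewrite filter-++ isEnd? loops gadgets
            | pairs≡
            | concatMap-++ gadgetFor ys ((x , y) ∷ zs)
            | gadgetFor-nonEdge x≢y xy∉E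
      = Occurs-++ˡ _ (filter-infix-occurs (concatMap gadgetFor ys) (gadget k l x y) _
          (subst (Occurs (tWord k l)) (sym (filter-all isEnd? gadget-within)) (gadget-occurs k l x≢y)))

    adjacent-if-avoids : x ≢ y → ¬ Occurs (tWord k l) (filter isEnd? word) → adj x y ≡ true
    adjacent-if-avoids x≢y avoids with adj x y in xy∈E
    ... | true  = refl
    ... | false = ⊥-elim (avoids (nonEdge-restriction x≢y xy∈E))

theorem7 : (k l : ℕ) → k ≥ 1 → l ≥ 1 →
    (n : ℕ) (G : SimpleGraph n) → Representable (tWord k l) G
theorem7 (suc k′) (suc l′) (s≤s _) (s≤s _) n G =
  word , word-covers , λ x y x≢y →
    (λ xy∈E → LongRuns-avoid k′ l′ (edge-restriction x y xy∈E)) , adjacent-if-avoids x y x≢y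
  where open Representation (suc k′) (suc l′) n G
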